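{- Let $G$ be a finite abelian group with exponent $n$, let $A \subset \mathbb{Z}$ be a non-empty set, and let $d$ be a positive divisor of $n$. Then $\mathsf{D}_{dA}(G) = \mathsf{D}_{A}(dG)$, where $dA = \{da \colon a \in A\}$ and $dG = \{dg \colon g \in G\}$.
   Context: Groups are written additively. For a finite abelian group $H$ and a non-empty set of weights $A \subset \mathbb{Z}$, the $A$-weighted Davenport constant $\mathsf{D}_A(H)$ is the smallest positive integer $\ell$ such that for every sequence $g_1, \dots, g_k$ of elements of $H$ (repetitions allowed) with $k \ge \ell$ there exist a non-empty subset $I \subset \{1,\dots,k\}$ and weights $a_i \in A$ ($i \in I$) with $\sum_{i\in I} a_i g_i = 0$. -}

module Defs where

open import Level using (Level; _⊔_)
open import Algebra.Bundles using (AbelianGroup)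
open import Data.Nat as ℕ using (ℕ; zero; suc; _≤_; NonZero)
open import Data.Integer as ℤ using (ℤ; +_; -[1+_])
open import Data.Fin using (Fin) renaming (zero to fzero; suc to fsuc)
open import Data.Bool using (Bool; true; false; T)
open import Data.List using (List)
open import Data.List.Relation.Unary.Any using (Any)
open import Data.Product using (Σ; ∃; _×_; _,_)
open import Relation.Unary using (Pred)
open import Data.Unit using (⊤)
open import Relation.Binary.PropositionalEquality using (_≡_)

module _ {c ℓ : Level} (G : AbelianGroup c ℓ) where
  open AbelianGroup G

  _·ℕ_ : ℕ → Carrier → Carrier
  zero  ·ℕ g = ε
  suc n ·ℕ g = g ∙ (n ·ℕ g)

  _·ℤ_ : ℤ → Carrier → Carrier
  (+ n)      ·ℤ g = n ·ℕ g
  (-[1+ n ]) ·ℤ g = (suc n ·ℕ g) ⁻¹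

  Σfin : (k : ℕ) → (Fin k → Carrier) → Carrier
  Σfin zero    f = ε
  Σfin (suc k) f = f fzero ∙ Σfin k (λ i → f (fsuc i))

  IsFinite : Set (c ⊔ ℓ)
  IsFinite = Σ (List Carrier) λ xs → ∀ g → Any (g ≈_) xs

  IsExponent : ℕ → Set (c ⊔ ℓ)
  IsExponent n = (1 ≤ n) × (∀ g → n ·ℕ g ≈ ε)
               × (∀ m → 1 ≤ m → (∀ g → m ·ℕ g ≈ ε) → n ≤ m)

  mulSet : ℕ → Pred Carrier (c ⊔ ℓ)
  mulSet d h = ∃ λ g → h ≈ d ·ℕ g

  HasWeightedZeroSubsum : ∀ {a} → Pred ℤ a → (k : ℕ)
                          → (Fin k → Carrier) → Set (ℓ ⊔ a)
  HasWeightedZeroSubsum A k g =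
    Σ (Fin k → Bool) λ I → Σ (Fin k → ℤ) λ w →
      (∃ λ i → T (I i)) × (∀ i → T (I i) → A (w i)) ×
      (Σfin k (λ i → sel (I i) (w i ·ℤ g i)) ≈ ε)
    where
      sel : Bool → Carrier → Carrier
      sel true  x = x
      sel false _ = ε

  DavProp : ∀ {h a} → Pred Carrier h → Pred ℤ a → ℕ → Set (c ⊔ ℓ ⊔ h ⊔ a)
  DavProp H A l = ∀ k → l ≤ k → (g : Fin k → Carrier) → (∀ i → H (g i))
                  → HasWeightedZeroSubsum A k g

  IsDavenport : ∀ {h a} → Pred Carrier h → Pred ℤ a → ℕ → Set (c ⊔ ℓ ⊔ h ⊔ a)
  IsDavenport H A l = (1 ≤ l) × DavProp H A l
                    × (∀ m → 1 ≤ m → DavProp H A m → l ≤ m)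

  Whole : Pred Carrier Level.zero
  Whole _ = ⊤

scaleSet : ∀ {a} → ℕ → Pred ℤ a → Pred ℤ a
scaleSet d A x = ∃ λ y → A y × (x ≡ (+ d) ℤ.* y)

{-# OPTIONS --safe #-}
module Submission where

open import Defs
open import Level using (Level)
open import Algebra.Bundles using (AbelianGroup)
open import Data.Nat using (ℕ; _≤_)
open import Data.Nat.Divisibility using (_∣_)
open import Data.Integer using (ℤ)
open import Data.Product using (∃; _×_)
open import Relation.Unary using (Pred)
open import Function.Bundles using (_⇔_)

open import Data.Nat as ℕ using (zero; suc)
open import Data.Nat.Properties using (*-comm)
open import Data.Integer as ℤ using (+_; -[1+_])
open import Data.Integer.Properties using (pos-*; neg-distribʳ-*)
open import Data.Fin using (Fin) renaming (zero to fzero; suc to fsuc)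
open import Data.Bool using (Bool; true; false; T)
open import Data.Unit using (tt)
open import Data.Product using (Σ; _,_; proj₁; proj₂)
open import Function.Bundles using (mk⇔; Equivalence)
open import Relation.Binary.PropositionalEquality as ≡ using (_≡_)
import Algebra.Properties.Group as GroupProperties
import Algebra.Properties.Monoid.Mult as MonoidMult

-- Multiplication by d maps G onto dG, and (d a) g = a (d g). Hence a sequence g₁ … g_k has a
-- zero subsum with weights in dA exactly when d g₁ … d g_k has one with weights in A, and
-- every sequence in dG is of the form d g₁ … d g_k. So the two Davenport properties hold for
-- the same lengths, and their least lengths agree.

module _ {c ℓ} (G : AbelianGroup c ℓ) where
  open AbelianGroup G
  open GroupProperties group using (ε⁻¹≈ε)
  open MonoidMult monoid using (×-congʳ; ×-assocˡ) renaming (_×_ to _×ₘ_)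
  open import Relation.Binary.Reasoning.Setoid setoid

  infixr 8 _·_ _·ᶻ_

  _·_ : ℕ → Carrier → Carrier
  _·_ = _·ℕ_ G

  _·ᶻ_ : ℤ → Carrier → Carrier
  _·ᶻ_ = _·ℤ_ G

  ·≡×ₘ : ∀ n x → n · x ≡ n ×ₘ x
  ·≡×ₘ zero    x = ≡.refl
  ·≡×ₘ (suc n) x = ≡.cong (x ∙_) (·≡×ₘ n x)

  ·-congʳ : ∀ n {x y} → x ≈ y → n · x ≈ n · y
  ·-congʳ n {x} {y} x≈y = begin
    n · x  ≡⟨ ·≡×ₘ n x ⟩
    n ×ₘ x ≈⟨ ×-congʳ n x≈y ⟩
    n ×ₘ y ≡⟨ ·≡×ₘ n y ⟨
    n · y  ∎

  ·-assoc : ∀ m n x → (m ℕ.* n) · x ≈ n · m · x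
  ·-assoc m n x = begin
    (m ℕ.* n) · x   ≡⟨ ·≡×ₘ (m ℕ.* n) x ⟩
    (m ℕ.* n) ×ₘ x  ≡⟨ ≡.cong (_×ₘ x) (*-comm m n) ⟩
    (n ℕ.* m) ×ₘ x  ≈⟨ ×-assocˡ x n m ⟨
    n ×ₘ m ×ₘ x     ≡⟨ ≡.cong (n ×ₘ_) (·≡×ₘ m x) ⟨
    n ×ₘ m · x      ≡⟨ ·≡×ₘ n (m · x) ⟨
    n · m · x       ∎

  ·ᶻ-congʳ : ∀ a {x y} → x ≈ y → a ·ᶻ x ≈ a ·ᶻ y
  ·ᶻ-congʳ (+ n)    x≈y = ·-congʳ n x≈y
  ·ᶻ-congʳ -[1+ n ] x≈y = ⁻¹-cong (·-congʳ (suc n) x≈y)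

  ·ᶻ-neg : ∀ n x → (ℤ.- + n) ·ᶻ x ≈ (n · x) ⁻¹
  ·ᶻ-neg zero    x = sym ε⁻¹≈ε
  ·ᶻ-neg (suc n) x = refl

  ·ᶻ-scaleˡ : ∀ d a x → (+ d ℤ.* a) ·ᶻ x ≈ a ·ᶻ d · x
  ·ᶻ-scaleˡ d (+ n) x = begin
    (+ d ℤ.* + n) ·ᶻ x  ≡⟨ ≡.cong (_·ᶻ x) (pos-* d n) ⟨
    (d ℕ.* n) · x       ≈⟨ ·-assoc d n x ⟩
    n · d · x           ∎
  ·ᶻ-scaleˡ d -[1+ n ] x = begin
    (+ d ℤ.* -[1+ n ]) ·ᶻ x       ≡⟨ ≡.cong (_·ᶻ x) (neg-distribʳ-* (+ d) (+ suc n)) ⟨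
    (ℤ.- (+ d ℤ.* + suc n)) ·ᶻ x  ≡⟨ ≡.cong (λ a → (ℤ.- a) ·ᶻ x) (pos-* d (suc n)) ⟨
    (ℤ.- + (d ℕ.* suc n)) ·ᶻ x    ≈⟨ ·ᶻ-neg (d ℕ.* suc n) x ⟩
    ((d ℕ.* suc n) · x) ⁻¹        ≈⟨ ⁻¹-cong (·-assoc d (suc n) x) ⟩
    (suc n · d · x) ⁻¹            ∎

  Σfin-cong : ∀ k {f f′ : Fin k → Carrier} → (∀ i → f i ≈ f′ i) → Σfin G k f ≈ Σfin G k f′
  Σfin-cong zero    f≈f′ = refl
  Σfin-cong (suc k) f≈f′ = ∙-cong (f≈f′ fzero) (Σfin-cong k (λ i → f≈f′ (fsuc i)))

  -- `HasWeightedZeroSubsum` forms its summands with a selector local to its definition, which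
  -- cannot be named here; this reads the summands for I and w off the type by unification.
  summands : ∀ {a} (A : Pred ℤ a) k (g : Fin k → Carrier) → (Fin k → Bool) → (Fin k → ℤ) → Fin k → Carrier
  summands {a} A k g = summandsOf ≡.refl
    where
    summandsOf : {P : (Fin k → Bool) → (Fin k → ℤ) → Set}
                 {Q : (Fin k → Bool) → (Fin k → ℤ) → Set a}
                 {F : (Fin k → Bool) → (Fin k → ℤ) → Fin k → Carrier}
               → HasWeightedZeroSubsum G A k g
                 ≡ (Σ (Fin k → Bool) λ I → Σ (Fin k → ℤ) λ w → P I w × Q I w × (Σfin G k (F I w) ≈ ε))
               → (Fin k → Bool) → (Fin k → ℤ) → Fin k → Carrier
    summandsOf {F = F} _ = F

  reweight : ∀ {a a′} {A : Pred ℤ a} {A′ : Pred ℤ a′} {k} {g g′ : Fin k → Carrier}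
           → (∀ i u → A u → ∃ λ v → A′ v × v ·ᶻ g′ i ≈ u ·ᶻ g i)
           → HasWeightedZeroSubsum G A k g → HasWeightedZeroSubsum G A′ k g′
  reweight {A = A} {A′} {k} {g} {g′} convert (I , w , nonempty , weighted , zero-sum) =
    I , w′ , nonempty , weighted′ , trans (Σfin-cong k same-summand) zero-sum
    where
    converted : ∀ i → T (I i) → ∃ λ v → A′ v × v ·ᶻ g′ i ≈ w i ·ᶻ g i
    converted i selected = convert i (w i) (weighted i selected)

    w′ : Fin k → ℤ
    w′ i with I i | converted i
    ... | true  | c = proj₁ (c tt)
    ... | false | _ = + 0

    weighted′ : ∀ i → T (I i) → A′ (w′ i)
    weighted′ i with I i | converted i
    ... | true  | c = λ _ → proj₁ (proj₂ (c tt))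
    ... | false | _ = λ ()

    same-summand : ∀ i → summands A′ k g′ I w′ i ≈ summands A k g I w i
    same-summand i with I i | converted i
    ... | true  | c = proj₂ (proj₂ (c tt))
    ... | false | _ = refl

  module _ (d : ℕ) {a} (A : Pred ℤ a) where

    multiples⇒scaledWeights : ∀ m → DavProp G (mulSet G d) A m → DavProp G (Whole G) (scaleSet d A) m
    multiples⇒scaledWeights m dav k m≤k g _ =
      reweight scale (dav k m≤k (λ i → d · g i) (λ i → g i , refl))
      where
      scale : ∀ i u → A u → ∃ λ v → scaleSet d A v × v ·ᶻ g i ≈ u ·ᶻ d · g i
      scale i u u∈A = + d ℤ.* u , (u , u∈A , ≡.refl) , ·ᶻ-scaleˡ d u (g i)

    scaledWeights⇒multiples : ∀ m → DavProp G (Whole G) (scaleSet d A) m → DavProp G (mulSet G d) A m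
    scaledWeights⇒multiples m dav k m≤k h h∈dG = reweight unscale (dav k m≤k g _)
      where
      g : Fin k → Carrier
      g i = proj₁ (h∈dG i)

      unscale : ∀ i u → scaleSet d A u → ∃ λ v → A v × v ·ᶻ h i ≈ u ·ᶻ g i
      unscale i _ (v , v∈A , ≡.refl) =
        v , v∈A , trans (·ᶻ-congʳ v (proj₂ (h∈dG i))) (sym (·ᶻ-scaleˡ d v (g i)))

    DavProp-scaleSet⇔mulSet : ∀ m → DavProp G (Whole G) (scaleSet d A) m ⇔ DavProp G (mulSet G d) A m
    DavProp-scaleSet⇔mulSet m = mk⇔ (scaledWeights⇒multiples m) (multiples⇒scaledWeights m)

  IsDavenport-cong : ∀ {h h′ a a′} {H : Pred Carrier h} {H′ : Pred Carrier h′} {A : Pred ℤ a} {A′ : Pred ℤ a′}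
                   → (∀ m → DavProp G H A m ⇔ DavProp G H′ A′ m)
                   → ∀ l → IsDavenport G H A l ⇔ IsDavenport G H′ A′ l
  IsDavenport-cong dav⇔ l = mk⇔
    (λ (1≤l , dav , least) → 1≤l , to (dav⇔ l) dav , λ m 1≤m dav′ → least m 1≤m (from (dav⇔ m) dav′))
    (λ (1≤l , dav , least) → 1≤l , from (dav⇔ l) dav , λ m 1≤m dav′ → least m 1≤m (to (dav⇔ m) dav′))
    where open Equivalence

lemma2p2 : ∀ {c ℓ a : Level} (G : AbelianGroup c ℓ) → IsFinite G
             → (n : ℕ) → IsExponent G n
             → (A : Pred ℤ a) → (∃ λ x → A x)
             → (d : ℕ) → 1 ≤ d → d ∣ n
             → (l : ℕ) → IsDavenport G (Whole G) (scaleSet d A) l ⇔ IsDavenport G (mulSet G d) A l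
lemma2p2 G _ _ _ A _ d _ _ =
  IsDavenport-cong G {H = Whole G} {mulSet G d} {scaleSet d A} {A} (DavProp-scaleSet⇔mulSet G d A)
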